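{- (Subject reduction.) Let $\Gamma$ be a finite map from variables to types, $\Delta$ a finite map from continuation variables to arrow-free types, $t, t'$ terms and $\rho$ a type. If $\Gamma;\Delta \vdash t : \rho$ and $t \to t'$, then $\Gamma;\Delta \vdash t' : \rho$.
   Context: Calculus $\lambda^{::}_{\mathtt{catch}}$. Types: $\sigma,\tau,\rho ::= \mathtt{unit} \mid \mathtt{list}\,\tau \mid \sigma\to\tau$ ($\to$ associates to the right). A type is arrow-free if it contains no $\to$; $\psi$ ranges over arrow-free types. Terms: $t,r,s ::= x \mid () \mid \mathtt{nil} \mid (::) \mid \mathtt{lrec} \mid \lambda x.r \mid t\,s \mid \mathtt{catch}\,\alpha\,t \mid \mathtt{throw}\,\alpha\,t$, where $x$ ranges over variables and $\alpha,\beta$ over continuation variables; $\lambda x$ binds $x$ and $\mathtt{catch}\,\alpha$ binds $\alpha$ (terms modulo renaming of bound variables); application associates to the left; $t :: r$ abbreviates $(::)\,t\,r$. $\mathrm{FCV}(t)$ is the set of free continuation variables; $t[x:=r]$ is capture-avoiding substitution. Values: $v,w ::= x \mid () \mid \mathtt{nil} \mid (::) \mid (::)\,v \mid (::)\,v\,w \mid \mathtt{lrec} \mid \mathtt{lrec}\,v \mid \mathtt{lrec}\,v\,w \mid \lambda x.r$. Contexts $E ::= \Box\,t \mid v\,\Box \mid \mathtt{throw}\,\alpha\,\Box$. Reduction $\to$ is the compatible closure (closure under all term constructors) of: $(\lambda x.t)\,v \to t[x:=v]$; $E[\mathtt{throw}\,\alpha\,t] \to \mathtt{throw}\,\alpha\,t$;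 $\mathtt{catch}\,\alpha\,(\mathtt{throw}\,\alpha\,t) \to \mathtt{catch}\,\alpha\,t$; $\mathtt{catch}\,\alpha\,(\mathtt{throw}\,\beta\,v) \to \mathtt{throw}\,\beta\,v$ if $\alpha\notin\{\beta\}\cup\mathrm{FCV}(v)$; $\mathtt{catch}\,\alpha\,v \to v$ if $\alpha\notin\mathrm{FCV}(v)$; $\mathtt{lrec}\,v_r\,v_s\,\mathtt{nil} \to v_r$; $\mathtt{lrec}\,v_r\,v_s\,(v_h :: v_t) \to v_s\,v_h\,v_t\,(\mathtt{lrec}\,v_r\,v_s\,v_t)$. Typing $\Gamma;\Delta\vdash t:\rho$ ($\Gamma$ maps variables to types, $\Delta$ maps continuation variables to arrow-free types) is given by: $x:\rho$ if $x:\rho\in\Gamma$; $():\mathtt{unit}$; $\mathtt{nil}:\mathtt{list}\,\sigma$; $(::):\sigma\to\mathtt{list}\,\sigma\to\mathtt{list}\,\sigma$; $\mathtt{lrec}:\rho\to(\sigma\to\mathtt{list}\,\sigma\to\rho\to\rho)\to\mathtt{list}\,\sigma\to\rho$ (any $\sigma,\rho$); if $\Gamma,x:\sigma;\Delta\vdash t:\tau$ then $\Gamma;\Delta\vdash\lambda x.t:\sigma\to\tau$; if $\Gamma;\Delta\vdash t:\sigma\to\tau$ and $\Gamma;\Delta\vdash s:\sigma$ then $\Gamma;\Delta\vdash ts:\tau$; if $\Gamma;\Delta,\alpha:\psi\vdash t:\psi$ with $\psi$ arrow-free then $\Gamma;\Delta\vdash\mathtt{catch}\,\alpha\,t:\psi$;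 if $\Gamma;\Delta\vdash t:\psi$ and $\alpha:\psi\in\Delta$ then $\Gamma;\Delta\vdash\mathtt{throw}\,\alpha\,t:\tau$ for any type $\tau$. -}

module Defs where

-- Calculus λ^{::}_catch with de Bruijn indices for both term variables
-- and continuation variables (terms are thereby taken modulo renaming
-- of bound variables, as in the paper).

open import Data.Nat using (ℕ; zero; suc)
open import Data.List using (List; []; _∷_)
open import Data.List.Relation.Unary.All using (All)
open import Function using (_∘_)

infixr 7 _⇒_

data Ty : Set where
  unit : Ty
  list : Ty → Ty
  _⇒_  : Ty → Ty → Ty

data ArrowFree : Ty → Set where
  af-unit : ArrowFree unit
  af-list : ∀ {τ} → ArrowFree τ → ArrowFree (list τ)

-- Terms.  var n : term variable (de Bruijn index), lam binds a term
-- variable, catch binds a continuation variable, throw α t uses the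
-- continuation variable with de Bruijn index α.
data Tm : Set where
  var   : ℕ → Tm
  ⋆     : Tm
  nil   : Tm
  cons  : Tm
  lrec  : Tm
  lam   : Tm → Tm
  app   : Tm → Tm → Tm
  catch : Tm → Tm
  throw : ℕ → Tm → Tm

data Value : Tm → Set where
  v-var   : ∀ x → Value (var x)
  v-unit  : Value ⋆
  v-nil   : Value nil
  v-cons0 : Value cons
  v-cons1 : ∀ {v} → Value v → Value (app cons v)
  v-cons2 : ∀ {v w} → Value v → Value w → Value (app (app cons v) w)
  v-lrec0 : Value lrec
  v-lrec1 : ∀ {v} → Value v → Value (app lrec v)
  v-lrec2 : ∀ {v w} → Value v → Value w → Value (app (app lrec v) w)
  v-lam   : ∀ t → Value (lam t)

lift : (ℕ → ℕ) → ℕ → ℕ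
lift f zero    = zero
lift f (suc n) = suc (f n)

ren : (ℕ → ℕ) → Tm → Tm
ren f (var x)     = var (f x)
ren f ⋆           = ⋆
ren f nil         = nil
ren f cons        = cons
ren f lrec        = lrec
ren f (lam t)     = lam (ren (lift f) t)
ren f (app t s)   = app (ren f t) (ren f s)
ren f (catch t)   = catch (ren f t)
ren f (throw a t) = throw a (ren f t)

cren : (ℕ → ℕ) → Tm → Tm
cren f (var x)     = var x
cren f ⋆           = ⋆
cren f nil         = nil
cren f cons        = cons
cren f lrec        = lrec
cren f (lam t)     = lam (cren f t)
cren f (app t s)   = app (cren f t) (cren f s)
cren f (catch t)   = catch (cren (lift f) t)
cren f (throw a t) = throw (f a) (cren f t)

-- weakening w.r.t. continuation variables: cwk v is v seen under one more
-- catch-binder that does not occur in it.  A term u satisfies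
-- "index 0 ∉ FCV(u)" iff u ≡ cwk v for some v.
cwk : Tm → Tm
cwk = cren suc

exts : (ℕ → Tm) → ℕ → Tm
exts σ zero    = var zero
exts σ (suc n) = ren suc (σ n)

sub : (ℕ → Tm) → Tm → Tm
sub σ (var x)     = σ x
sub σ ⋆           = ⋆
sub σ nil         = nil
sub σ cons        = cons
sub σ lrec        = lrec
sub σ (lam t)     = lam (sub (exts σ) t)
sub σ (app t s)   = app (sub σ t) (sub σ s)
sub σ (catch t)   = catch (sub (cwk ∘ σ) t)
sub σ (throw a t) = throw a (sub σ t)

single : Tm → ℕ → Tm
single v zero    = v
single v (suc n) = var n

_[0:=_] : Tm → Tm → Tm
t [0:= v ] = sub (single v) t

infix 4 _⟶_
data _⟶_ : Tm → Tm → Set where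
  β-lam      : ∀ {t v} → Value v → app (lam t) v ⟶ t [0:= v ]
  -- E[throw α t] → throw α t, for E = □ t | v □ | throw β □
  throw-appl : ∀ {a t s} → app (throw a t) s ⟶ throw a t
  throw-appr : ∀ {v a t} → Value v → app v (throw a t) ⟶ throw a t
  throw-thr  : ∀ {b a t} → throw b (throw a t) ⟶ throw a t
  catch-thr-same : ∀ {t} → catch (throw zero t) ⟶ catch t
  -- catch α (throw β v) → throw β v   if α ∉ {β} ∪ FCV(v)
  catch-thr-other : ∀ {b v} → Value v → catch (throw (suc b) (cwk v)) ⟶ throw b v
  -- catch α v → v   if α ∉ FCV(v)
  catch-val  : ∀ {v} → Value v → catch (cwk v) ⟶ v
  lrec-nil   : ∀ {vr vs} → Value vr → Value vs →
               app (app (app lrec vr) vs) nil ⟶ vr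
  lrec-cons  : ∀ {vr vs vh vt} → Value vr → Value vs → Value vh → Value vt →
               app (app (app lrec vr) vs) (app (app cons vh) vt)
                 ⟶ app (app (app vs vh) vt) (app (app (app lrec vr) vs) vt)
  ξ-lam   : ∀ {t t'} → t ⟶ t' → lam t ⟶ lam t'
  ξ-appl  : ∀ {t t' s} → t ⟶ t' → app t s ⟶ app t' s
  ξ-appr  : ∀ {t s s'} → s ⟶ s' → app t s ⟶ app t s'
  ξ-catch : ∀ {t t'} → t ⟶ t' → catch t ⟶ catch t'
  ξ-throw : ∀ {a t t'} → t ⟶ t' → throw a t ⟶ throw a t'

infix 4 _∋_∶_
data _∋_∶_ : List Ty → ℕ → Ty → Set where
  here  : ∀ {Γ ρ} → (ρ ∷ Γ) ∋ zero ∶ ρ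
  there : ∀ {Γ σ n ρ} → Γ ∋ n ∶ ρ → (σ ∷ Γ) ∋ suc n ∶ ρ

infix 3 _︔_⊢_∶_
data _︔_⊢_∶_ (Γ : List Ty) (Δ : List Ty) : Tm → Ty → Set where
  ty-var   : ∀ {x ρ} → Γ ∋ x ∶ ρ → Γ ︔ Δ ⊢ var x ∶ ρ
  ty-unit  : Γ ︔ Δ ⊢ ⋆ ∶ unit
  ty-nil   : ∀ {σ} → Γ ︔ Δ ⊢ nil ∶ list σ
  ty-cons  : ∀ {σ} → Γ ︔ Δ ⊢ cons ∶ σ ⇒ list σ ⇒ list σ
  ty-lrec  : ∀ {σ ρ} → Γ ︔ Δ ⊢ lrec ∶ ρ ⇒ (σ ⇒ list σ ⇒ ρ ⇒ ρ) ⇒ list σ ⇒ ρ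
  ty-lam   : ∀ {t σ τ} → (σ ∷ Γ) ︔ Δ ⊢ t ∶ τ → Γ ︔ Δ ⊢ lam t ∶ σ ⇒ τ
  ty-app   : ∀ {t s σ τ} → Γ ︔ Δ ⊢ t ∶ σ ⇒ τ → Γ ︔ Δ ⊢ s ∶ σ → Γ ︔ Δ ⊢ app t s ∶ τ
  ty-catch : ∀ {t ψ} → ArrowFree ψ → Γ ︔ (ψ ∷ Δ) ⊢ t ∶ ψ → Γ ︔ Δ ⊢ catch t ∶ ψ
  ty-throw : ∀ {a t ψ τ} → Δ ∋ a ∶ ψ → Γ ︔ Δ ⊢ t ∶ ψ → Γ ︔ Δ ⊢ throw a t ∶ τ

-- Each redex is typed by inverting its typing derivation; only three
-- rules need more than reassembling subderivations: β needs the
-- substitution lemma, and the two rules that discard a catch binder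
-- need strengthening of the continuation context, available because
-- the discarded index does not occur in the result (it is a cwk v).
module Submission where

open import Defs
open import Data.Nat using (ℕ; zero; suc)
open import Data.List using (List; _∷_)
open import Data.List.Relation.Unary.All using (All)

infix 4 _∶_⇒ᵣ_ _∶_⇐ᵣ_

_∶_⇒ᵣ_ : (ℕ → ℕ) → List Ty → List Ty → Set
f ∶ Γ ⇒ᵣ Γ' = ∀ {x τ} → Γ ∋ x ∶ τ → Γ' ∋ f x ∶ τ

_∶_⇐ᵣ_ : (ℕ → ℕ) → List Ty → List Ty → Set
f ∶ Γ ⇐ᵣ Γ' = ∀ {x τ} → Γ' ∋ f x ∶ τ → Γ ∋ x ∶ τ

lift-⇒ᵣ : ∀ {f Γ Γ' σ} → f ∶ Γ ⇒ᵣ Γ' → lift f ∶ σ ∷ Γ ⇒ᵣ σ ∷ Γ'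
lift-⇒ᵣ h here      = here
lift-⇒ᵣ h (there p) = there (h p)

lift-⇐ᵣ : ∀ {f Γ Γ' σ} → f ∶ Γ ⇐ᵣ Γ' → lift f ∶ σ ∷ Γ ⇐ᵣ σ ∷ Γ'
lift-⇐ᵣ h {zero}  here      = here
lift-⇐ᵣ h {suc x} (there p) = there (h p)

suc-⇐ᵣ : ∀ {Γ σ} → suc ∶ Γ ⇐ᵣ σ ∷ Γ
suc-⇐ᵣ (there p) = p

ren-preserves-type : ∀ {Γ Γ' Δ t ρ f} → f ∶ Γ ⇒ᵣ Γ' →
  Γ ︔ Δ ⊢ t ∶ ρ → Γ' ︔ Δ ⊢ ren f t ∶ ρ
ren-preserves-type h (ty-var p)     = ty-var (h p)
ren-preserves-type h ty-unit        = ty-unit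
ren-preserves-type h ty-nil         = ty-nil
ren-preserves-type h ty-cons        = ty-cons
ren-preserves-type h ty-lrec        = ty-lrec
ren-preserves-type h (ty-lam d)     = ty-lam (ren-preserves-type (lift-⇒ᵣ h) d)
ren-preserves-type h (ty-app d e)   = ty-app (ren-preserves-type h d) (ren-preserves-type h e)
ren-preserves-type h (ty-catch a d) = ty-catch a (ren-preserves-type h d)
ren-preserves-type h (ty-throw p d) = ty-throw p (ren-preserves-type h d)

cren-preserves-type : ∀ {Γ Δ Δ' t ρ f} → f ∶ Δ ⇒ᵣ Δ' →
  Γ ︔ Δ ⊢ t ∶ ρ → Γ ︔ Δ' ⊢ cren f t ∶ ρ
cren-preserves-type h (ty-var p)     = ty-var p
cren-preserves-type h ty-unit        = ty-unit
cren-preserves-type h ty-nil         = ty-nil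
cren-preserves-type h ty-cons        = ty-cons
cren-preserves-type h ty-lrec        = ty-lrec
cren-preserves-type h (ty-lam d)     = ty-lam (cren-preserves-type h d)
cren-preserves-type h (ty-app d e)   = ty-app (cren-preserves-type h d) (cren-preserves-type h e)
cren-preserves-type h (ty-catch a d) = ty-catch a (cren-preserves-type (lift-⇒ᵣ h) d)
cren-preserves-type h (ty-throw p d) = ty-throw (h p) (cren-preserves-type h d)

cren-reflects-type : ∀ {Γ Δ Δ' ρ f} → f ∶ Δ ⇐ᵣ Δ' →
  (t : Tm) → Γ ︔ Δ' ⊢ cren f t ∶ ρ → Γ ︔ Δ ⊢ t ∶ ρ
cren-reflects-type h (var x)     (ty-var p)     = ty-var p
cren-reflects-type h ⋆           ty-unit        = ty-unit
cren-reflects-type h nil         ty-nil         = ty-nil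
cren-reflects-type h cons        ty-cons        = ty-cons
cren-reflects-type h lrec        ty-lrec        = ty-lrec
cren-reflects-type h (lam t)     (ty-lam d)     = ty-lam (cren-reflects-type h t d)
cren-reflects-type h (app t s)   (ty-app d e)   =
  ty-app (cren-reflects-type h t d) (cren-reflects-type h s e)
cren-reflects-type h (catch t)   (ty-catch a d) = ty-catch a (cren-reflects-type (lift-⇐ᵣ h) t d)
cren-reflects-type h (throw a t) (ty-throw p d) = ty-throw (h p) (cren-reflects-type h t d)

cwk-strengthen : ∀ {Γ Δ ψ ρ} (t : Tm) → Γ ︔ ψ ∷ Δ ⊢ cwk t ∶ ρ → Γ ︔ Δ ⊢ t ∶ ρ
cwk-strengthen = cren-reflects-type suc-⇐ᵣ

infix 4 _∶_⇒ₛ_︔_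

_∶_⇒ₛ_︔_ : (ℕ → Tm) → List Ty → List Ty → List Ty → Set
σ ∶ Γ ⇒ₛ Γ' ︔ Δ = ∀ {x τ} → Γ ∋ x ∶ τ → Γ' ︔ Δ ⊢ σ x ∶ τ

exts-⇒ₛ : ∀ {σ Γ Γ' Δ τ} → σ ∶ Γ ⇒ₛ Γ' ︔ Δ → exts σ ∶ τ ∷ Γ ⇒ₛ τ ∷ Γ' ︔ Δ
exts-⇒ₛ h here      = ty-var here
exts-⇒ₛ h (there p) = ren-preserves-type there (h p)

cwk-⇒ₛ : ∀ {σ Γ Γ' Δ ψ} → σ ∶ Γ ⇒ₛ Γ' ︔ Δ → (λ x → cwk (σ x)) ∶ Γ ⇒ₛ Γ' ︔ ψ ∷ Δ
cwk-⇒ₛ h p = cren-preserves-type there (h p)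

single-⇒ₛ : ∀ {Γ Δ v σ} → Γ ︔ Δ ⊢ v ∶ σ → single v ∶ σ ∷ Γ ⇒ₛ Γ ︔ Δ
single-⇒ₛ d here      = d
single-⇒ₛ d (there p) = ty-var p

sub-preserves-type : ∀ {Γ Γ' Δ t ρ σ} → σ ∶ Γ ⇒ₛ Γ' ︔ Δ →
  Γ ︔ Δ ⊢ t ∶ ρ → Γ' ︔ Δ ⊢ sub σ t ∶ ρ
sub-preserves-type h (ty-var p)     = h p
sub-preserves-type h ty-unit        = ty-unit
sub-preserves-type h ty-nil         = ty-nil
sub-preserves-type h ty-cons        = ty-cons
sub-preserves-type h ty-lrec        = ty-lrec
sub-preserves-type h (ty-lam d)     = ty-lam (sub-preserves-type (exts-⇒ₛ h) d)
sub-preserves-type h (ty-app d e)   = ty-app (sub-preserves-type h d) (sub-preserves-type h e)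
sub-preserves-type h (ty-catch a d) = ty-catch a (sub-preserves-type (cwk-⇒ₛ h) d)
sub-preserves-type h (ty-throw p d) = ty-throw p (sub-preserves-type h d)

[0:=]-preserves-type : ∀ {Γ Δ t v σ τ} →
  σ ∷ Γ ︔ Δ ⊢ t ∶ τ → Γ ︔ Δ ⊢ v ∶ σ → Γ ︔ Δ ⊢ t [0:= v ] ∶ τ
[0:=]-preserves-type d e = sub-preserves-type (single-⇒ₛ e) d

⟶-preserves-type : ∀ {Γ Δ t t' ρ} → t ⟶ t' → Γ ︔ Δ ⊢ t ∶ ρ → Γ ︔ Δ ⊢ t' ∶ ρ
⟶-preserves-type (β-lam _) (ty-app (ty-lam d) e) = [0:=]-preserves-type d e
⟶-preserves-type throw-appl (ty-app (ty-throw p d) _) = ty-throw p d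
⟶-preserves-type (throw-appr _) (ty-app _ (ty-throw p e)) = ty-throw p e
⟶-preserves-type throw-thr (ty-throw _ (ty-throw q d)) = ty-throw q d
⟶-preserves-type catch-thr-same (ty-catch a (ty-throw here d)) = ty-catch a d
⟶-preserves-type (catch-thr-other {v = v} _) (ty-catch _ (ty-throw (there p) d)) =
  ty-throw p (cwk-strengthen v d)
⟶-preserves-type (catch-val {v = v} _) (ty-catch _ d) = cwk-strengthen v d
⟶-preserves-type (lrec-nil _ _) (ty-app (ty-app (ty-app ty-lrec r) _) ty-nil) = r
⟶-preserves-type (lrec-cons _ _ _ _)
  (ty-app (ty-app (ty-app ty-lrec r) s) (ty-app (ty-app ty-cons h) tl)) =
  ty-app (ty-app (ty-app s h) tl) (ty-app (ty-app (ty-app ty-lrec r) s) tl)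
⟶-preserves-type (ξ-lam r)   (ty-lam d)     = ty-lam (⟶-preserves-type r d)
⟶-preserves-type (ξ-appl r)  (ty-app d e)   = ty-app (⟶-preserves-type r d) e
⟶-preserves-type (ξ-appr r)  (ty-app d e)   = ty-app d (⟶-preserves-type r e)
⟶-preserves-type (ξ-catch r) (ty-catch a d) = ty-catch a (⟶-preserves-type r d)
⟶-preserves-type (ξ-throw r) (ty-throw p d) = ty-throw p (⟶-preserves-type r d)

theorem2p13 : (Γ Δ : List Ty) → All ArrowFree Δ → (t t' : Tm) (ρ : Ty) →
    Γ ︔ Δ ⊢ t ∶ ρ → t ⟶ t' → Γ ︔ Δ ⊢ t' ∶ ρ
theorem2p13 _ _ _ _ _ _ d r = ⟶-preserves-type r d
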